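{- For every integer $m \ge 0$, the square of side $n = 4m+2$ can be tiled with T-tetrominos and exactly $4$ monominos. Moreover, every tiling of this square by T-tetrominos and monominos uses at least $4$ monominos.
   Context: A T-tetromino is a polyomino made of four unit squares, three in a row and a fourth attached to the middle square of that row on one side, in any rotation or reflection. A monomino is a single unit square. A tiling of a region made of unit lattice squares is a placement of tiles aligned with the unit grid such that the tiles are pairwise non-overlapping and their union is exactly the region. -}

module Defs where

open import Data.Nat using (ℕ; zero; suc; _+_; _*_; _<_)
open import Data.Product using (_×_; _,_; ∃-syntax)
open import Data.List using (List; []; _∷_; length; lookup)
open import Data.List.Relation.Unary.All using (All)
open import Data.List.Membership.Propositional using (_∈_)
open import Data.Fin using (Fin)
open import Relation.Binary.PropositionalEquality using (_≡_)

-- A unit lattice square is identified with its lower-left corner (x , y).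
Cell : Set
Cell = ℕ × ℕ

-- The four rotations of the T-tetromino (reflections of a T coincide with
-- rotations, so these are all placements up to translation).
data Orient : Set where
  up down left right : Orient

-- A tile: a monomino at a cell, or a T-tetromino in a given orientation whose
-- bounding box has lower-left corner (a , b).
data Tile : Set where
  mono : ℕ → ℕ → Tile
  tee  : Orient → ℕ → ℕ → Tile

cells : Tile → List Cell
cells (mono a b)      = (a , b) ∷ []
cells (tee up a b)    = (a , b) ∷ (suc a , b) ∷ (suc (suc a) , b) ∷ (suc a , suc b) ∷ []
cells (tee down a b)  = (a , suc b) ∷ (suc a , suc b) ∷ (suc (suc a) , suc b) ∷ (suc a , b) ∷ []
cells (tee right a b) = (a , b) ∷ (a , suc b) ∷ (a , suc (suc b)) ∷ (suc a , suc b) ∷ []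
cells (tee left a b)  = (suc a , b) ∷ (suc a , suc b) ∷ (suc a , suc (suc b)) ∷ (a , suc b) ∷ []

InSquare : ℕ → Cell → Set
InSquare n (x , y) = (x < n) × (y < n)

Tiling : ℕ → List Tile → Set
Tiling n ts =
  All (λ t → All (InSquare n) (cells t)) ts
  × (∀ c → InSquare n c → ∃[ i ] (c ∈ cells (lookup ts i)))
  × (∀ (i j : Fin (length ts)) (c : Cell) →
       c ∈ cells (lookup ts i) → c ∈ cells (lookup ts j) → i ≡ j)

numMono : List Tile → ℕ
numMono []              = 0
numMono (mono _ _ ∷ ts) = suc (numMono ts)
numMono (tee _ _ _ ∷ ts) = numMono ts

-- Lower bound: colour the board like a checkerboard. Every T-tetromino covers an odd number
-- of black cells. The area of the square, 4K² with K = 2m + 1 odd, is a multiple of 4, so a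
-- tiling with fewer than 4 monominoes has none, hence uses K² T-tetrominoes and covers an odd
-- number of black cells; but the square has 2K² black cells.
--
-- Construction: the square of side N + 2 (N = 4m) minus its corner cell is tiled with T's and
-- 3 monominoes, by induction on m. For N = 0 three monominoes do it. To pass from N to N + 4,
-- shift the old tiling by (4, 4), tile the two 4 × N strips along the new left and bottom
-- edges with 4 × 4 blocks, and fill the remaining 6 × 6 corner, which includes the hole (4, 4)
-- of the shifted tiling, with eight T's. A final monomino fills the corner cell.
module Submission where

open import Defs
open import Level using (0ℓ)
open import Algebra.Bundles using (CommutativeMonoid)
open import Data.Empty using (⊥-elim)
open import Data.Fin using (Fin) renaming (zero to fzero; suc to fsuc)
import Data.Fin.Properties as Fin
open import Data.List using (List; []; _∷_; _++_; length; lookup; map; foldr)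
open import Data.List.Properties using (++-assoc; map-++; length-++)
open import Data.List.Membership.Propositional using (_∈_)
open import Data.List.Membership.Propositional.Properties
  using (∈-++⁺ˡ; ∈-++⁺ʳ; ∈-++⁻; ∈-map⁺)
open import Data.List.Membership.Propositional.Properties.WithK using (unique∧set⇒bag)
open import Data.List.Relation.Binary.BagAndSetEquality using (∼bag⇒↭)
open import Data.List.Relation.Binary.Permutation.Propositional using (_↭_; ↭⇒↭ₛ)
open import Data.List.Relation.Binary.Permutation.Propositional.Properties
  using (↭-length) renaming (map⁺ to ↭-map⁺)
open import Data.List.Relation.Binary.Permutation.Setoid.Properties using (foldr-commMonoid)
open import Data.List.Relation.Unary.All as All using (All; []; _∷_)
import Data.List.Relation.Unary.All.Properties as All
open import Data.List.Relation.Unary.AllPairs using ([]; _∷_)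
open import Data.List.Relation.Unary.Any using (here; there)
open import Data.List.Relation.Unary.Unique.Propositional using (Unique)
import Data.List.Relation.Unary.Unique.Propositional.Properties as Unique
open import Data.Nat
  using (ℕ; zero; suc; z<s; _+_; _*_; _∸_; _%_; _≤_; _<_; _≟_; _<?_; _≤?_; parity)
open import Data.Nat.DivMod using (m<n⇒m%n≡m; [m+kn]%n≡m%n; m*n%n≡0)
open import Data.Nat.Properties
open import Data.Nat.Tactic.RingSolver using (solve-∀)
open import Data.Parity.Base as ℙ using (Parity; 0ℙ; 1ℙ; _⁻¹)
import Data.Parity.Properties as ℙ
open import Data.Product using (_×_; _,_; ∃-syntax; proj₁; proj₂)
open import Data.Product.Properties using (≡-dec)
open import Data.Sum using (_⊎_; inj₁; inj₂; [_,_])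
open import Function using (_∘_; id)
open import Function.Bundles using (mk⇔)
open import Relation.Binary.PropositionalEquality
  using (_≡_; _≢_; refl; sym; trans; cong; cong₂; subst; module ≡-Reasoning)
open import Relation.Nullary using (Dec; yes; no; ¬_)
open import Relation.Nullary.Decidable using (from-yes; map′; _×-dec_; _⊎-dec_; _→-dec_; ¬?)
open import Relation.Unary using (Pred; Decidable; _∪_; _∖_; _⊆_; _≐_; _⊥_; ｛_｝)
open import Relation.Unary.Properties using (≐-sym)
open import Data.List.Membership.DecPropositional (≡-dec _≟_ _≟_) using (_∈?_)
open import Data.List.Relation.Unary.Unique.DecPropositional (≡-dec _≟_ _≟_) using (unique?)

_≟ᶜ_ : (c c′ : Cell) → Dec (c ≡ c′)
_≟ᶜ_ = ≡-dec _≟_ _≟_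

Region : Set₁
Region = Pred Cell 0ℓ

cellsOf : List Tile → List Cell
cellsOf []       = []
cellsOf (t ∷ ts) = cells t ++ cellsOf ts

cellsOf-++ : ∀ ts us → cellsOf (ts ++ us) ≡ cellsOf ts ++ cellsOf us
cellsOf-++ []       us = refl
cellsOf-++ (t ∷ ts) us =
  trans (cong (cells t ++_) (cellsOf-++ ts us)) (sym (++-assoc (cells t) _ _))

∈-cellsOf⁻ : ∀ ts {c} → c ∈ cellsOf ts → ∃[ i ] c ∈ cells (lookup ts i)
∈-cellsOf⁻ (t ∷ ts) c∈ with ∈-++⁻ (cells t) c∈
... | inj₁ c∈t  = fzero , c∈t
... | inj₂ c∈ts = let i , c∈i = ∈-cellsOf⁻ ts c∈ts in fsuc i , c∈i

∈-cellsOf⁺ : ∀ ts i {c} → c ∈ cells (lookup ts i) → c ∈ cellsOf ts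
∈-cellsOf⁺ (t ∷ ts) fzero    c∈ = ∈-++⁺ˡ c∈
∈-cellsOf⁺ (t ∷ ts) (fsuc i) c∈ = ∈-++⁺ʳ (cells t) (∈-cellsOf⁺ ts i c∈)

All-cellsOf⁺ : ∀ {P : Region} ts → All (All P ∘ cells) ts → All P (cellsOf ts)
All-cellsOf⁺ []       []         = []
All-cellsOf⁺ (t ∷ ts) (pt ∷ pts) = All.++⁺ pt (All-cellsOf⁺ ts pts)

All-cellsOf⁻ : ∀ {P : Region} ts → All P (cellsOf ts) → All (All P ∘ cells) ts
All-cellsOf⁻ []       _  = []
All-cellsOf⁻ (t ∷ ts) ps = All.++⁻ˡ (cells t) ps ∷ All-cellsOf⁻ ts (All.++⁻ʳ (cells t) ps)

shiftCell : ℕ → ℕ → Cell → Cell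
shiftCell a b (x , y) = x + a , y + b

shiftCell-injective : ∀ a b {c c′} → shiftCell a b c ≡ shiftCell a b c′ → c ≡ c′
shiftCell-injective a b {x , y} {x′ , y′} eq =
  cong₂ _,_ (+-cancelʳ-≡ a x x′ (cong proj₁ eq)) (+-cancelʳ-≡ b y y′ (cong proj₂ eq))

shiftTile : ℕ → ℕ → Tile → Tile
shiftTile a b (mono x y)  = mono (x + a) (y + b)
shiftTile a b (tee o x y) = tee o (x + a) (y + b)

cells-shiftTile : ∀ a b t → cells (shiftTile a b t) ≡ map (shiftCell a b) (cells t)
cells-shiftTile a b (mono x y)      = refl
cells-shiftTile a b (tee up x y)    = refl
cells-shiftTile a b (tee down x y)  = refl
cells-shiftTile a b (tee left x y)  = refl
cells-shiftTile a b (tee right x y) = refl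

cellsOf-shift : ∀ a b ts → cellsOf (map (shiftTile a b) ts) ≡ map (shiftCell a b) (cellsOf ts)
cellsOf-shift a b []       = refl
cellsOf-shift a b (t ∷ ts) =
  trans (cong₂ _++_ (cells-shiftTile a b t) (cellsOf-shift a b ts))
        (sym (map-++ (shiftCell a b) (cells t) (cellsOf ts)))

cells-unique : ∀ t → Unique (cells t)
cells-unique (mono a b)  = [] ∷ []
cells-unique (tee o a b) =
  subst Unique (sym (cells-shiftTile a b (tee o 0 0)))
        (Unique.map⁺ (shiftCell-injective a b) (tee-unique o))
  where
  tee-unique : ∀ o → Unique (cells (tee o 0 0))
  tee-unique up    = from-yes (unique? (cells (tee up 0 0)))
  tee-unique down  = from-yes (unique? (cells (tee down 0 0)))
  tee-unique left  = from-yes (unique? (cells (tee left 0 0)))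
  tee-unique right = from-yes (unique? (cells (tee right 0 0)))

Tiles : Region → List Tile → Set
Tiles R ts = All R (cellsOf ts) × R ⊆ (_∈ cellsOf ts) × Unique (cellsOf ts)

NonOverlapping : List Tile → Set
NonOverlapping ts = ∀ (i j : Fin (length ts)) c →
  c ∈ cells (lookup ts i) → c ∈ cells (lookup ts j) → i ≡ j

nonOverlapping⇒unique : ∀ ts → NonOverlapping ts → Unique (cellsOf ts)
nonOverlapping⇒unique []       _        = []
nonOverlapping⇒unique (t ∷ ts) disjoint =
  Unique.++⁺ (cells-unique t) (nonOverlapping⇒unique ts disjoint-ts) apart
  where
  disjoint-ts : NonOverlapping ts
  disjoint-ts i j c p q = Fin.suc-injective (disjoint (fsuc i) (fsuc j) c p q)
  apart : ∀ {c} → ¬ (c ∈ cells t × c ∈ cellsOf ts)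
  apart {c} (c∈t , c∈ts) =
    let j , c∈j = ∈-cellsOf⁻ ts c∈ts in Fin.0≢1+n (disjoint fzero (fsuc j) c c∈t c∈j)

unique-++⇒apart : ∀ (xs : List Cell) {ys c} → Unique (xs ++ ys) → c ∈ xs → ¬ c ∈ ys
unique-++⇒apart (x ∷ xs) (x∉ ∷ _) (here refl)  c∈ys = All.lookup x∉ (∈-++⁺ʳ xs c∈ys) refl
unique-++⇒apart (x ∷ xs) (_ ∷ u)  (there c∈xs) c∈ys = unique-++⇒apart xs u c∈xs c∈ys

unique-++⇒uniqueʳ : ∀ (xs : List Cell) {ys} → Unique (xs ++ ys) → Unique ys
unique-++⇒uniqueʳ []       u       = u
unique-++⇒uniqueʳ (x ∷ xs) (_ ∷ u) = unique-++⇒uniqueʳ xs u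

unique⇒nonOverlapping : ∀ ts → Unique (cellsOf ts) → NonOverlapping ts
unique⇒nonOverlapping (t ∷ ts) u fzero    fzero    c p q = refl
unique⇒nonOverlapping (t ∷ ts) u fzero    (fsuc j) c p q =
  ⊥-elim (unique-++⇒apart (cells t) u p (∈-cellsOf⁺ ts j q))
unique⇒nonOverlapping (t ∷ ts) u (fsuc i) fzero    c p q =
  ⊥-elim (unique-++⇒apart (cells t) u q (∈-cellsOf⁺ ts i p))
unique⇒nonOverlapping (t ∷ ts) u (fsuc i) (fsuc j) c p q =
  cong fsuc (unique⇒nonOverlapping ts (unique-++⇒uniqueʳ (cells t) u) i j c p q)

tiling⇒tiles : ∀ {n} ts → Tiling n ts → Tiles (InSquare n) ts
tiling⇒tiles ts (inside , covered , disjoint) =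
  All-cellsOf⁺ ts inside ,
  (λ {c} c∈ → let i , c∈i = covered c c∈ in ∈-cellsOf⁺ ts i c∈i) ,
  nonOverlapping⇒unique ts disjoint

tiles⇒tiling : ∀ {n} ts → Tiles (InSquare n) ts → Tiling n ts
tiles⇒tiling ts (inside , covered , unique) =
  All-cellsOf⁻ ts inside ,
  (λ c c∈ → ∈-cellsOf⁻ ts (covered c∈)) ,
  unique⇒nonOverlapping ts unique

Tiles⇒↭ : ∀ {R} ts {xs} → Tiles R ts → Unique xs → R ⊆ (_∈ xs) → (_∈ xs) ⊆ R →
          cellsOf ts ↭ xs
Tiles⇒↭ ts (inside , covered , unique) xs-unique R⊆xs xs⊆R =
  ∼bag⇒↭ (unique∧set⇒bag unique xs-unique
    (mk⇔ (R⊆xs ∘ All.lookup inside) (covered ∘ xs⊆R)))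

Rect : ℕ → ℕ → Region
Rect w h (x , y) = x < w × y < h

Rect? : ∀ w h → Decidable (Rect w h)
Rect? w h (x , y) = (x <? w) ×-dec (y <? h)

rowCells : ℕ → ℕ → List Cell
rowCells x zero    = []
rowCells x (suc y) = (x , y) ∷ rowCells x y

rectCells : ℕ → ℕ → List Cell
rectCells zero    h = []
rectCells (suc x) h = rowCells x h ++ rectCells x h

∈-rowCells⁻ : ∀ {x h c} → c ∈ rowCells x h → proj₁ c ≡ x × proj₂ c < h
∈-rowCells⁻ {h = suc h} (here refl) = refl , ≤-refl
∈-rowCells⁻ {h = suc h} (there c∈)  = let x≡ , y<h = ∈-rowCells⁻ c∈ in x≡ , m<n⇒m<1+n y<h

∈-rowCells⁺ : ∀ {x h y} → y < h → (x , y) ∈ rowCells x h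
∈-rowCells⁺ {h = suc h} y<1+h with m<1+n⇒m<n∨m≡n y<1+h
... | inj₁ y<h  = there (∈-rowCells⁺ y<h)
... | inj₂ refl = here refl

∈-rectCells⁻ : ∀ {w h c} → c ∈ rectCells w h → Rect w h c
∈-rectCells⁻ {suc w} {h} c∈ with ∈-++⁻ (rowCells w h) c∈
... | inj₁ c∈row with ∈-rowCells⁻ c∈row
...   | refl , y<h = ≤-refl , y<h
∈-rectCells⁻ {suc w} {h} c∈ | inj₂ c∈rect =
  let x<w , y<h = ∈-rectCells⁻ c∈rect in m<n⇒m<1+n x<w , y<h

∈-rectCells⁺ : ∀ {w h c} → Rect w h c → c ∈ rectCells w h
∈-rectCells⁺ {suc w} {h} (x<1+w , y<h) with m<1+n⇒m<n∨m≡n x<1+w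
... | inj₁ x<w  = ∈-++⁺ʳ (rowCells w h) (∈-rectCells⁺ (x<w , y<h))
... | inj₂ refl = ∈-++⁺ˡ (∈-rowCells⁺ y<h)

rowCells-unique : ∀ x h → Unique (rowCells x h)
rowCells-unique x zero    = []
rowCells-unique x (suc h) =
  All.tabulate (λ c∈ eq → <-irrefl (sym (cong proj₂ eq)) (proj₂ (∈-rowCells⁻ c∈))) ∷
  rowCells-unique x h

rectCells-unique : ∀ w h → Unique (rectCells w h)
rectCells-unique zero    h = []
rectCells-unique (suc w) h = Unique.++⁺ (rowCells-unique w h) (rectCells-unique w h)
  λ (c∈row , c∈rect) → <-irrefl (proj₁ (∈-rowCells⁻ c∈row)) (proj₁ (∈-rectCells⁻ c∈rect))

length-rectCells : ∀ w h → length (rectCells w h) ≡ w * h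
length-rectCells zero    h = refl
length-rectCells (suc w) h =
  trans (length-++ (rowCells w h)) (cong₂ _+_ (length-rowCells h) (length-rectCells w h))
  where
  length-rowCells : ∀ h → length (rowCells w h) ≡ h
  length-rowCells zero    = refl
  length-rowCells (suc h) = cong suc (length-rowCells h)

tiling⇒↭ : ∀ {n} ts → Tiling n ts → cellsOf ts ↭ rectCells n n
tiling⇒↭ {n} ts tiling =
  Tiles⇒↭ ts (tiling⇒tiles ts tiling) (rectCells-unique n n) ∈-rectCells⁺ ∈-rectCells⁻

numTee : List Tile → ℕ
numTee []               = 0
numTee (mono _ _ ∷ ts)  = numTee ts
numTee (tee _ _ _ ∷ ts) = suc (numTee ts)

length-cellsOf : ∀ ts → length (cellsOf ts) ≡ 4 * numTee ts + numMono ts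
length-cellsOf []               = refl
length-cellsOf (mono _ _ ∷ ts)  =
  trans (cong suc (length-cellsOf ts)) (sym (+-suc (4 * numTee ts) (numMono ts)))
length-cellsOf (tee o a b ∷ ts) = begin
  length (cells (tee o a b) ++ cellsOf ts)         ≡⟨ length-++ (cells (tee o a b)) ⟩
  length (cells (tee o a b)) + length (cellsOf ts) ≡⟨ cong₂ _+_ (length-tee o) (length-cellsOf ts) ⟩
  4 + (4 * numTee ts + numMono ts)                 ≡⟨ tee-area (numTee ts) (numMono ts) ⟩
  4 * suc (numTee ts) + numMono ts                 ∎
  where
  open ≡-Reasoning
  length-tee : ∀ o → length (cells (tee o a b)) ≡ 4
  length-tee up    = refl
  length-tee down  = refl
  length-tee left  = refl
  length-tee right = refl
  tee-area : ∀ t k → 4 + (4 * t + k) ≡ 4 * suc t + k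
  tee-area = solve-∀

4*t+k≡4*s⇒k≡0∧t≡s : ∀ t k s → 4 * t + k ≡ 4 * s → k < 4 → k ≡ 0 × t ≡ s
4*t+k≡4*s⇒k≡0∧t≡s t k s eq k<4 =
  k≡0 , *-cancelˡ-≡ t s 4 4t≡4s
  where
  open ≡-Reasoning
  k≡0 : k ≡ 0
  k≡0 = begin
    k                 ≡⟨ m<n⇒m%n≡m k<4 ⟨
    k % 4             ≡⟨ [m+kn]%n≡m%n k t 4 ⟨
    (k + t * 4) % 4   ≡⟨ cong (_% 4) (trans (+-comm k (t * 4)) (cong (_+ k) (*-comm t 4))) ⟩
    (4 * t + k) % 4   ≡⟨ cong (_% 4) eq ⟩
    (4 * s) % 4       ≡⟨ cong (_% 4) (*-comm 4 s) ⟩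
    (s * 4) % 4       ≡⟨ m*n%n≡0 s 4 ⟩
    0                 ∎
  4t≡4s : 4 * t ≡ 4 * s
  4t≡4s = trans (sym (+-identityʳ (4 * t))) (subst (λ k → 4 * t + k ≡ 4 * s) k≡0 eq)

numMono<4⇒teesOnly : ∀ K ts → Tiling (K + K) ts → numMono ts < 4 →
                     numMono ts ≡ 0 × numTee ts ≡ K * K
numMono<4⇒teesOnly K ts tiling <4 = 4*t+k≡4*s⇒k≡0∧t≡s (numTee ts) (numMono ts) (K * K) area <4
  where
  open ≡-Reasoning
  double-square : ∀ K → (K + K) * (K + K) ≡ 4 * (K * K)
  double-square = solve-∀
  area : 4 * numTee ts + numMono ts ≡ 4 * (K * K)
  area = begin
    4 * numTee ts + numMono ts         ≡⟨ length-cellsOf ts ⟨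
    length (cellsOf ts)                ≡⟨ ↭-length (tiling⇒↭ ts tiling) ⟩
    length (rectCells (K + K) (K + K)) ≡⟨ length-rectCells (K + K) (K + K) ⟩
    (K + K) * (K + K)                  ≡⟨ double-square K ⟩
    4 * (K * K)                        ∎

-- The checkerboard colouring

colour : Cell → Parity
colour (x , y) = parity x ℙ.+ parity y

colourSum : List Cell → Parity
colourSum cs = foldr ℙ._+_ 0ℙ (map colour cs)

colourSum-++ : ∀ xs ys → colourSum (xs ++ ys) ≡ colourSum xs ℙ.+ colourSum ys
colourSum-++ []       ys = refl
colourSum-++ (c ∷ xs) ys =
  trans (cong (colour c ℙ.+_) (colourSum-++ xs ys)) (sym (ℙ.+-assoc (colour c) _ _))

colourSum-↭ : ∀ {xs ys} → xs ↭ ys → colourSum xs ≡ colourSum ys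
colourSum-↭ xs↭ys =
  foldr-commMonoid ℙ+.setoid ℙ+.isCommutativeMonoid (↭⇒↭ₛ (↭-map⁺ colour xs↭ys))
  where module ℙ+ = CommutativeMonoid ℙ.+-0-commutativeMonoid

parity-suc : ∀ n → parity (suc n) ≡ parity n ⁻¹
parity-suc n = sym (ℙ.suc-homo-⁻¹ (suc n))

colourSum-tee : ∀ o a b → colourSum (cells (tee o a b)) ≡ 1ℙ
colourSum-tee up a b rewrite parity-suc a | parity-suc b with parity a | parity b
... | 0ℙ | 0ℙ = refl
... | 0ℙ | 1ℙ = refl
... | 1ℙ | 0ℙ = refl
... | 1ℙ | 1ℙ = refl
colourSum-tee down a b rewrite parity-suc a | parity-suc b with parity a | parity b
... | 0ℙ | 0ℙ = refl
... | 0ℙ | 1ℙ = refl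
... | 1ℙ | 0ℙ = refl
... | 1ℙ | 1ℙ = refl
colourSum-tee left a b rewrite parity-suc a | parity-suc b with parity a | parity b
... | 0ℙ | 0ℙ = refl
... | 0ℙ | 1ℙ = refl
... | 1ℙ | 0ℙ = refl
... | 1ℙ | 1ℙ = refl
colourSum-tee right a b rewrite parity-suc a | parity-suc b with parity a | parity b
... | 0ℙ | 0ℙ = refl
... | 0ℙ | 1ℙ = refl
... | 1ℙ | 0ℙ = refl
... | 1ℙ | 1ℙ = refl

colourSum-cellsOf : ∀ ts → numMono ts ≡ 0 → colourSum (cellsOf ts) ≡ parity (numTee ts)
colourSum-cellsOf []               _       = refl
colourSum-cellsOf (tee o a b ∷ ts) no-mono = begin
  colourSum (cells (tee o a b) ++ cellsOf ts)
    ≡⟨ colourSum-++ (cells (tee o a b)) (cellsOf ts) ⟩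
  colourSum (cells (tee o a b)) ℙ.+ colourSum (cellsOf ts)
    ≡⟨ cong₂ ℙ._+_ (colourSum-tee o a b) (colourSum-cellsOf ts no-mono) ⟩
  parity (numTee ts) ⁻¹
    ≡⟨ parity-suc (numTee ts) ⟨
  parity (suc (numTee ts))
    ∎
  where open ≡-Reasoning

colourSum-rowCells : ∀ x k → colourSum (rowCells x (k + k)) ≡ parity k
colourSum-rowCells x zero    = refl
colourSum-rowCells x (suc k) rewrite +-suc k k | parity-suc (k + k) | parity-suc k =
  trans (adjacent-pair (parity x) (parity (k + k)) _) (cong _⁻¹ (colourSum-rowCells x k))
  where
  adjacent-pair : ∀ p q r → (p ℙ.+ q ⁻¹) ℙ.+ ((p ℙ.+ q) ℙ.+ r) ≡ r ⁻¹
  adjacent-pair 0ℙ 0ℙ r = refl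
  adjacent-pair 0ℙ 1ℙ r = refl
  adjacent-pair 1ℙ 0ℙ r = refl
  adjacent-pair 1ℙ 1ℙ r = refl

colourSum-rectCells : ∀ w k → colourSum (rectCells w (k + k)) ≡ parity (w * k)
colourSum-rectCells zero    k = refl
colourSum-rectCells (suc w) k = begin
  colourSum (rowCells w (k + k) ++ rectCells w (k + k))
    ≡⟨ colourSum-++ (rowCells w (k + k)) _ ⟩
  colourSum (rowCells w (k + k)) ℙ.+ colourSum (rectCells w (k + k))
    ≡⟨ cong₂ ℙ._+_ (colourSum-rowCells w k) (colourSum-rectCells w k) ⟩
  parity k ℙ.+ parity (w * k)
    ≡⟨ ℙ.+-homo-+ k (w * k) ⟨
  parity (suc w * k)
    ∎
  where open ≡-Reasoning

tiling⇒4≤numMono : ∀ K ts → parity K ≡ 1ℙ → Tiling (K + K) ts → 4 ≤ numMono ts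
tiling⇒4≤numMono K ts K-odd tiling with 4 ≤? numMono ts
... | yes 4≤ = 4≤
... | no  4≰ with numMono<4⇒teesOnly K ts tiling (≰⇒> 4≰)
...   | no-mono , tees≡ = ⊥-elim (1ℙ≢0ℙ (begin
  1ℙ                                    ≡⟨ cong₂ ℙ._*_ K-odd K-odd ⟨
  parity K ℙ.* parity K                 ≡⟨ ℙ.*-homo-* K K ⟨
  parity (K * K)                        ≡⟨ cong parity tees≡ ⟨
  parity (numTee ts)                    ≡⟨ colourSum-cellsOf ts no-mono ⟨
  colourSum (cellsOf ts)                ≡⟨ colourSum-↭ (tiling⇒↭ ts tiling) ⟩
  colourSum (rectCells (K + K) (K + K)) ≡⟨ colourSum-rectCells (K + K) K ⟩
  parity ((K + K) * K)                  ≡⟨ ℙ.*-homo-* (K + K) K ⟩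
  parity (K + K) ℙ.* parity K           ≡⟨ cong (ℙ._* parity K) (ℙ.+-homo-+ K K) ⟩
  (parity K ℙ.+ parity K) ℙ.* parity K  ≡⟨ cong (ℙ._* parity K) (ℙ.p+p≡0ℙ (parity K)) ⟩
  0ℙ                                    ∎))
  where
  open ≡-Reasoning
  1ℙ≢0ℙ : 1ℙ ≢ 0ℙ
  1ℙ≢0ℙ ()

Tileable : Region → ℕ → Set
Tileable R k = ∃[ ts ] (Tiles R ts × numMono ts ≡ k)

numMono-++ : ∀ ts us → numMono (ts ++ us) ≡ numMono ts + numMono us
numMono-++ []               us = refl
numMono-++ (mono _ _ ∷ ts)  us = cong suc (numMono-++ ts us)
numMono-++ (tee _ _ _ ∷ ts) us = numMono-++ ts us

numMono-shift : ∀ a b ts → numMono (map (shiftTile a b) ts) ≡ numMono ts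
numMono-shift a b []               = refl
numMono-shift a b (mono _ _ ∷ ts)  = cong suc (numMono-shift a b ts)
numMono-shift a b (tee _ _ _ ∷ ts) = numMono-shift a b ts

Tileable-≐ : ∀ {R S k} → R ≐ S → Tileable R k → Tileable S k
Tileable-≐ (R⊆S , S⊆R) (ts , (inside , covered , unique) , #mono) =
  ts , (All.map R⊆S inside , covered ∘ S⊆R , unique) , #mono

Tileable-∅ : ∀ {R} → (∀ {c} → ¬ R c) → Tileable R 0
Tileable-∅ R-empty = [] , ([] , ⊥-elim ∘ R-empty , []) , refl

Tileable-｛｝ : ∀ x y → Tileable ｛ x , y ｝ 1
Tileable-｛｝ x y = mono x y ∷ [] , ((refl ∷ []) , (λ { refl → here refl }) , [] ∷ []) , refl

Tileable-∪ : ∀ {R S j k} → R ⊥ S → Tileable R j → Tileable S k → Tileable (R ∪ S) (j + k)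
Tileable-∪ R⊥S (ts , (insideR , coveredR , uniqueR) , refl)
               (us , (insideS , coveredS , uniqueS) , refl) =
  ts ++ us ,
  subst (λ cs → All _ cs × _ ⊆ (_∈ cs) × Unique cs) (sym (cellsOf-++ ts us))
    ( All.++⁺ (All.map inj₁ insideR) (All.map inj₂ insideS)
    , [ ∈-++⁺ˡ ∘ coveredR , ∈-++⁺ʳ (cellsOf ts) ∘ coveredS ]
    , Unique.++⁺ uniqueR uniqueS
        (λ (c∈ts , c∈us) → R⊥S (All.lookup insideR c∈ts , All.lookup insideS c∈us)) ) ,
  numMono-++ ts us

Shift : ℕ → ℕ → Region → Region
Shift a b R c = ∃[ c′ ] (R c′ × c ≡ shiftCell a b c′)

Tileable-shift : ∀ {R k} a b → Tileable R k → Tileable (Shift a b R) k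
Tileable-shift a b (ts , (inside , covered , unique) , #mono) =
  map (shiftTile a b) ts ,
  subst (λ cs → All _ cs × _ ⊆ (_∈ cs) × Unique cs) (sym (cellsOf-shift a b ts))
    ( All.map⁺ (All.map (λ r → _ , r , refl) inside)
    , (λ { (_ , r , refl) → ∈-map⁺ (shiftCell a b) (covered r) })
    , Unique.map⁺ (shiftCell-injective a b) unique ) ,
  trans (numMono-shift a b ts) #mono

tiles? : ∀ {R} → Decidable R → ∀ {w h} → R ⊆ Rect w h → ∀ ts → Dec (Tiles R ts)
tiles? {R} R? {w} {h} R⊆ ts =
  All.all? R? (cellsOf ts) ×-dec covers? ×-dec unique? (cellsOf ts)
  where
  bounded⇒covers : (∀ {x} → x < w → ∀ {y} → y < h → R (x , y) → (x , y) ∈ cellsOf ts) →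
                   R ⊆ (_∈ cellsOf ts)
  bounded⇒covers covers {x , y} r = covers (proj₁ (R⊆ r)) (proj₂ (R⊆ r)) r
  covers? : Dec (R ⊆ (_∈ cellsOf ts))
  covers? = map′ bounded⇒covers (λ covers _ _ → covers)
    (allUpTo? (λ x → allUpTo? (λ y → R? (x , y) →-dec (x , y) ∈? cellsOf ts) h) w)

≐-｛｝∪∖ : ∀ {R : Region} c → R c → R ≐ ｛ c ｝ ∪ (R ∖ ｛ c ｝)
≐-｛｝∪∖ {R} c c∈R = split , join
  where
  split : R ⊆ ｛ c ｝ ∪ (R ∖ ｛ c ｝)
  split {c′} r with c ≟ᶜ c′
  ... | yes c≡c′ = inj₁ c≡c′
  ... | no  c≢c′ = inj₂ (r , c≢c′)
  join : ｛ c ｝ ∪ (R ∖ ｛ c ｝) ⊆ R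
  join (inj₁ refl)    = c∈R
  join (inj₂ (r , _)) = r

<-+-split : ∀ h k {x} → x < h + k → x < h ⊎ ∃[ i ] (i < k × x ≡ i + h)
<-+-split h k {x} x<h+k with x <? h
... | yes x<h = inj₁ x<h
... | no  x≮h = inj₂ (x ∸ h , x∸h<k , sym (m∸n+n≡m (≮⇒≥ x≮h)))
  where
  x∸h<k : x ∸ h < k
  x∸h<k = subst (x ∸ h <_) (m+n∸m≡n h k) (∸-monoˡ-< x<h+k (≮⇒≥ x≮h))

shift-< : ∀ h {i k} → i < k → i + h < h + k
shift-< h {i} {k} i<k = subst (i + h <_) (+-comm k h) (+-monoˡ-< h i<k)

Rect-stackᵛ : ∀ w h k → Rect w (h + k) ≐ Rect w h ∪ Shift 0 h (Rect w k)
Rect-stackᵛ w h k = split , join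
  where
  split : Rect w (h + k) ⊆ Rect w h ∪ Shift 0 h (Rect w k)
  split {x , y} (x<w , y<h+k) with <-+-split h k y<h+k
  ... | inj₁ y<h              = inj₁ (x<w , y<h)
  ... | inj₂ (j , j<k , refl) = inj₂ ((x , j) , (x<w , j<k) , cong (_, j + h) (sym (+-identityʳ x)))
  join : Rect w h ∪ Shift 0 h (Rect w k) ⊆ Rect w (h + k)
  join (inj₁ (x<w , y<h))                    = x<w , <-≤-trans y<h (m≤m+n h k)
  join (inj₂ ((x , j) , (x<w , j<k) , refl)) = subst (_< w) (sym (+-identityʳ x)) x<w , shift-< h j<k

Rect-stackʰ : ∀ w k h → Rect (w + k) h ≐ Rect w h ∪ Shift w 0 (Rect k h)
Rect-stackʰ w k h = split , join
  where
  split : Rect (w + k) h ⊆ Rect w h ∪ Shift w 0 (Rect k h)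
  split {x , y} (x<w+k , y<h) with <-+-split w k x<w+k
  ... | inj₁ x<w              = inj₁ (x<w , y<h)
  ... | inj₂ (i , i<k , refl) = inj₂ ((i , y) , (i<k , y<h) , cong (i + w ,_) (sym (+-identityʳ y)))
  join : Rect w h ∪ Shift w 0 (Rect k h) ⊆ Rect (w + k) h
  join (inj₁ (x<w , y<h))                    = <-≤-trans x<w (m≤m+n w k) , y<h
  join (inj₂ ((i , y) , (i<k , y<h) , refl)) = shift-< w i<k , subst (_< h) (sym (+-identityʳ y)) y<h

Tileable-Rect-*ᵛ : ∀ {w h} → Tileable (Rect w h) 0 → ∀ k → Tileable (Rect w (k * h)) 0
Tileable-Rect-*ᵛ         tileable zero    = Tileable-∅ λ ()
Tileable-Rect-*ᵛ {w} {h} tileable (suc k) =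
  Tileable-≐ {R = Rect w h ∪ Shift 0 h (Rect w (k * h))} (≐-sym (Rect-stackᵛ w h (k * h)))
    (Tileable-∪ apart tileable (Tileable-shift 0 h (Tileable-Rect-*ᵛ tileable k)))
  where
  apart : Rect w h ⊥ Shift 0 h (Rect w (k * h))
  apart ((_ , y<h) , ((x , j) , _ , refl)) = m+n≮n j h y<h

Tileable-Rect-*ʰ : ∀ {w h} → Tileable (Rect w h) 0 → ∀ k → Tileable (Rect (k * w) h) 0
Tileable-Rect-*ʰ         tileable zero    = Tileable-∅ λ ()
Tileable-Rect-*ʰ {w} {h} tileable (suc k) =
  Tileable-≐ {R = Rect w h ∪ Shift w 0 (Rect (k * w) h)} (≐-sym (Rect-stackʰ w (k * w) h))
    (Tileable-∪ apart tileable (Tileable-shift w 0 (Tileable-Rect-*ʰ tileable k)))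
  where
  apart : Rect w h ⊥ Shift w 0 (Rect (k * w) h)
  apart ((x<w , _) , ((i , y) , _ , refl)) = m+n≮n i w x<w

block : Tileable (Rect 4 4) 0
block = blockTiles , from-yes (tiles? (Rect? 4 4) id blockTiles) , refl
  where
  blockTiles : List Tile
  blockTiles = tee up 0 0 ∷ tee left 2 0 ∷ tee right 0 1 ∷ tee down 1 2 ∷ []

-- Growing the punctured square

Punctured : ℕ → Region
Punctured N = InSquare (2 + N) ∖ ｛ 0 , 0 ｝

-- the 6 × 6 square without (4 , 5), (5 , 4) and (5 , 5), which the shifted old tiling covers
CornerShape : Region
CornerShape (x , y) = x < 6 × y < 6 × (x < 4 ⊎ y < 4 ⊎ x ≡ 4 × y ≡ 4)

Corner : Region
Corner = CornerShape ∖ ｛ 0 , 0 ｝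

corner : Tileable Corner 0
corner =
  cornerTiles , from-yes (tiles? Corner? (λ ((x<6 , y<6 , _) , _) → x<6 , y<6) cornerTiles) , refl
  where
  cornerTiles : List Tile
  cornerTiles = tee down 0 0 ∷ tee up 2 0 ∷ tee left 4 0 ∷ tee up 0 2 ∷ tee left 2 2 ∷
                tee right 4 2 ∷ tee right 0 3 ∷ tee down 1 4 ∷ []
  Corner? : Decidable Corner
  Corner? (x , y) =
    ((x <? 6) ×-dec (y <? 6) ×-dec ((x <? 4) ⊎-dec (y <? 4) ⊎-dec ((x ≟ 4) ×-dec (y ≟ 4))))
    ×-dec ¬? ((0 , 0) ≟ᶜ (x , y))

≢-shifted : ∀ {x b} i {a} → x < b → b ≤ a → x ≢ i + a
≢-shifted i {a} x<b b≤a refl = m+n≮n i a (<-≤-trans x<b b≤a)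

module Growth (N : ℕ) where

  Old Left Bottom : Region
  Old    = Shift 4 4 (Punctured N)
  Left   = Shift 0 6 (Rect 4 N)
  Bottom = Shift 6 0 (Rect N 4)

  Bottom⊥Old : Bottom ⊥ Old
  Bottom⊥Old (((x , y) , (_ , y<4) , refl) , ((i , j) , _ , eq)) =
    ≢-shifted j y<4 ≤-refl (trans (sym (+-identityʳ y)) (cong proj₂ eq))

  Left⊥Bottom∪Old : Left ⊥ (Bottom ∪ Old)
  Left⊥Bottom∪Old (((x , y) , (x<4 , _) , refl) , inj₁ ((i , j) , _ , eq)) =
    ≢-shifted i x<4 (m≤m+n 4 2) (trans (sym (+-identityʳ x)) (cong proj₁ eq))
  Left⊥Bottom∪Old (((x , y) , (x<4 , _) , refl) , inj₂ ((i , j) , _ , eq)) =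
    ≢-shifted i x<4 ≤-refl (trans (sym (+-identityʳ x)) (cong proj₁ eq))

  Corner⊥Rest : Corner ⊥ (Left ∪ (Bottom ∪ Old))
  Corner⊥Rest (((_ , y<6 , _) , _) , inj₁ ((x , j) , _ , refl))    = m+n≮n j 6 y<6
  Corner⊥Rest (((x<6 , _) , _) , inj₂ (inj₁ ((i , y) , _ , refl))) = m+n≮n i 6 x<6
  Corner⊥Rest (((_ , _ , inj₁ x<4) , _) , inj₂ (inj₂ ((i , j) , _ , refl))) =
    m+n≮n i 4 x<4
  Corner⊥Rest (((_ , _ , inj₂ (inj₁ y<4)) , _) , inj₂ (inj₂ ((i , j) , _ , refl))) =
    m+n≮n j 4 y<4
  Corner⊥Rest (((_ , _ , inj₂ (inj₂ (i+4≡4 , j+4≡4))) , _) ,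
               inj₂ (inj₂ ((i , j) , (_ , not-origin) , refl))) =
    not-origin (cong₂ _,_ (sym (+-cancelʳ-≡ 4 i 0 i+4≡4)) (sym (+-cancelʳ-≡ 4 j 0 j+4≡4)))

  pieces⊆Punctured : Corner ∪ (Left ∪ (Bottom ∪ Old)) ⊆ Punctured (4 + N)
  pieces⊆Punctured (inj₁ ((x<6 , y<6 , _) , not-origin)) =
    (<-≤-trans x<6 (m≤m+n 6 N) , <-≤-trans y<6 (m≤m+n 6 N)) , not-origin
  pieces⊆Punctured (inj₂ (inj₁ ((x , j) , (x<4 , j<N) , refl))) =
    (subst (_< 6 + N) (sym (+-identityʳ x)) (<-≤-trans x<4 (m≤m+n 4 (2 + N))) , shift-< 6 j<N) ,
    λ eq → m+1+n≢0 j (sym (cong proj₂ eq))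
  pieces⊆Punctured (inj₂ (inj₂ (inj₁ ((i , y) , (i<N , y<4) , refl)))) =
    (shift-< 6 i<N , subst (_< 6 + N) (sym (+-identityʳ y)) (<-≤-trans y<4 (m≤m+n 4 (2 + N)))) ,
    λ eq → m+1+n≢0 i (sym (cong proj₁ eq))
  pieces⊆Punctured (inj₂ (inj₂ (inj₂ ((i , j) , ((i<2+N , j<2+N) , _) , refl)))) =
    (shift-< 4 i<2+N , shift-< 4 j<2+N) , λ eq → m+1+n≢0 i (sym (cong proj₁ eq))

  Punctured⊆pieces : Punctured (4 + N) ⊆ Corner ∪ (Left ∪ (Bottom ∪ Old))
  Punctured⊆pieces {x , y} ((x< , y<) , not-origin)
    with <-+-split 4 (2 + N) x< | <-+-split 4 (2 + N) y<
  ... | inj₁ x<4 | inj₁ y<4 =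
    inj₁ ((<-≤-trans x<4 (m≤m+n 4 2) , <-≤-trans y<4 (m≤m+n 4 2) , inj₁ x<4) , not-origin)
  ... | inj₁ x<4 | inj₂ (j , j<2+N , refl) with <-+-split 2 N j<2+N
  ...   | inj₁ j<2 =
    inj₁ ((<-≤-trans x<4 (m≤m+n 4 2) , shift-< 4 j<2 , inj₁ x<4) , not-origin)
  ...   | inj₂ (j′ , j′<N , refl) =
    inj₂ (inj₁ ((x , j′) , (x<4 , j′<N) , cong₂ _,_ (sym (+-identityʳ x)) (+-assoc j′ 2 4)))
  Punctured⊆pieces {x , y} ((x< , y<) , not-origin) | inj₂ (i , i<2+N , refl) | inj₁ y<4
    with <-+-split 2 N i<2+N
  ... | inj₁ i<2 =
    inj₁ ((shift-< 4 i<2 , <-≤-trans y<4 (m≤m+n 4 2) , inj₂ (inj₁ y<4)) , not-origin)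
  ... | inj₂ (i′ , i′<N , refl) =
    inj₂ (inj₂ (inj₁ ((i′ , y) , (i′<N , y<4) ,
                      cong₂ _,_ (+-assoc i′ 2 4) (sym (+-identityʳ y)))))
  Punctured⊆pieces {x , y} ((x< , y<) , not-origin)
    | inj₂ (i , i<2+N , refl) | inj₂ (j , j<2+N , refl)
    with (0 , 0) ≟ᶜ (i , j)
  ... | yes refl = inj₁ ((m<m+n 4 z<s , m<m+n 4 z<s , inj₂ (inj₂ (refl , refl))) , λ ())
  ... | no  ≢0   = inj₂ (inj₂ (inj₂ ((i , j) , ((i<2+N , j<2+N) , ≢0) , refl)))

  grow : ∀ {k} → Tileable (Punctured N) k → Tileable (Rect 4 N) 0 → Tileable (Rect N 4) 0 →
         Tileable (Punctured (4 + N)) k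
  grow punctured leftStrip bottomStrip =
    Tileable-≐ {R = Corner ∪ (Left ∪ (Bottom ∪ Old))} (pieces⊆Punctured , Punctured⊆pieces)
      (Tileable-∪ Corner⊥Rest corner
        (Tileable-∪ Left⊥Bottom∪Old (Tileable-shift 0 6 leftStrip)
          (Tileable-∪ Bottom⊥Old (Tileable-shift 6 0 bottomStrip) (Tileable-shift 4 4 punctured))))

open Growth using (grow)

Tileable-Punctured : ∀ m → Tileable (Punctured (m * 4)) 3
Tileable-Punctured zero    = base , from-yes (tiles? Punctured? proj₁ base) , refl
  where
  base : List Tile
  base = mono 1 0 ∷ mono 0 1 ∷ mono 1 1 ∷ []
  Punctured? : Decidable (Punctured 0)
  Punctured? c = Rect? 2 2 c ×-dec ¬? ((0 , 0) ≟ᶜ c)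
Tileable-Punctured (suc m) =
  grow (m * 4) (Tileable-Punctured m) (Tileable-Rect-*ᵛ block m) (Tileable-Rect-*ʰ block m)

Tileable-square : ∀ m → Tileable (InSquare (2 + m * 4)) 4
Tileable-square m =
  Tileable-≐ {R = ｛ 0 , 0 ｝ ∪ Punctured (m * 4)} (≐-sym (≐-｛｝∪∖ (0 , 0) (z<s , z<s)))
    (Tileable-∪ (λ { (refl , _ , not-origin) → not-origin refl })
                (Tileable-｛｝ 0 0) (Tileable-Punctured m))

proposition2 : (∀ (m : ℕ) → ∃[ ts ] (Tiling (4 * m + 2) ts × numMono ts ≡ 4))
               × (∀ (m : ℕ) (ts : List Tile) → Tiling (4 * m + 2) ts → 4 ≤ numMono ts)
proposition2 = construction , lower-bound
  where
  side≡ : ∀ m → 2 + m * 4 ≡ 4 * m + 2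
  side≡ = solve-∀
  halves : ∀ m → 4 * m + 2 ≡ (2 * m + 1) + (2 * m + 1)
  halves = solve-∀
  construction : ∀ m → ∃[ ts ] (Tiling (4 * m + 2) ts × numMono ts ≡ 4)
  construction m with Tileable-square m
  ... | ts , tiles , #mono = ts , subst (λ n → Tiling n ts) (side≡ m) (tiles⇒tiling ts tiles) , #mono
  lower-bound : ∀ m ts → Tiling (4 * m + 2) ts → 4 ≤ numMono ts
  lower-bound m ts tiling =
    tiling⇒4≤numMono (2 * m + 1) ts half-odd (subst (λ n → Tiling n ts) (halves m) tiling)
    where
    half-odd : parity (2 * m + 1) ≡ 1ℙ
    half-odd = trans (ℙ.+-homo-+ (2 * m) 1) (cong (ℙ._+ 1ℙ) (ℙ.*-homo-* 2 m))
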